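{- The Kolakoski sequence $S$ is recurrent if and only if for every positive integer $k$ there is a $k$-regular prefix of $S$.
   Context: Words are over the alphabet $\{1,2\}$; $|v|$ is the length of $v$. For a finite or infinite word $v=a_1a_2\cdots$, its integral $v^{ -1}$ is obtained by replacing each letter $a_i$ by $a_i$ copies of the letter $1$ if $i$ is odd and by $a_i$ copies of the letter $2$ if $i$ is even. Set $v^0=v$, $v^{ -k}=(v^{ -(k-1)})^{ -1}$. The Kolakoski sequence $S=1221121221\cdots$ is the unique infinite word over $\{1,2\}$ with $S^{ -1}=S$. A prefix $w$ of $S$ is $k$-regular if $|w^{ -h}|$ is even for all $0\le h\le k$. $S$ is recurrent if every finite subword of $S$ occurs at least twice in $S$. -}

module Defs where

open import Data.Nat using (ℕ; zero; suc; _≤_; _<_)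
open import Data.Nat.Divisibility using (_∣_)
open import Data.List using (List; []; _∷_; _++_; replicate; length)
open import Data.Product using (Σ; _×_; ∃; ∃-syntax)
open import Relation.Binary.PropositionalEquality using (_≡_; _≢_)
open import Function using (_∘_)

data Letter : Set where
  one two : Letter

val : Letter → ℕ
val one = 1
val two = 2

Word : Set
Word = List Letter

-- infinite words (0-indexed)
InfWord : Set
InfWord = ℕ → Letter

other : Letter → Letter
other one = two
other two = one

-- integral with the current output letter c (one at odd 1-based positions,
-- two at even 1-based positions)
integralFrom : Letter → Word → Word
integralFrom c [] = []
integralFrom c (a ∷ v) = replicate (val a) c ++ integralFrom (other c) v

integral : Word → Word
integral = integralFrom one

integralPow : ℕ → Word → Word
integralPow zero v = v
integralPow (suc h) v = integral (integralPow h v)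

takeω : ℕ → InfWord → Word
takeω zero s = []
takeω (suc n) s = s 0 ∷ takeω n (s ∘ suc)

dropω : ℕ → InfWord → InfWord
dropω i s n = s (i Data.Nat.+ n)

IsPrefix : Word → InfWord → Set
IsPrefix u s = takeω (length u) s ≡ u

-- integral of an infinite word: w = v⁻¹ iff the integral of every finite
-- prefix of v is a prefix of w
IsIntegralOf : InfWord → InfWord → Set
IsIntegralOf w v = ∀ n → IsPrefix (integral (takeω n v)) w

-- S is the Kolakoski sequence: S⁻¹ = S (this determines S uniquely)
IsKolakoski : InfWord → Set
IsKolakoski S = IsIntegralOf S S

OccursAt : Word → InfWord → ℕ → Set
OccursAt u s i = IsPrefix u (dropω i s)

Recurrent : InfWord → Set
Recurrent s = ∀ (u : Word) → (∃[ i ] OccursAt u s i) →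
  ∃[ i ] ∃[ j ] (i ≢ j × OccursAt u s i × OccursAt u s j)

KRegular : ℕ → Word → Set
KRegular k w = ∀ h → h ≤ k → 2 ∣ length (integralPow h w)

HasKRegularPrefix : ℕ → InfWord → Set
HasKRegularPrefix k s = ∃[ w ] (1 ≤ length w × IsPrefix w s × KRegular k w)

-- If S is recurrent, the prefix of any length N returns at some position p ≥ 1, and p can be chosen
-- so that the prefix of length p is regular below any given level k: by induction on k, if two
-- suitable returns p and q (q a return of the first p + N letters) both have an odd k-th integral, then the
-- concatenation of the two prefixes, which is the prefix of length q + p, has an even one, because below a
-- regular level integration is additive over concatenation.
-- Conversely, if w is (m+1)-regular and Y consists of the two letters following w, then integrating wY
-- m+2 times gives a prefix w^{-(m+2)} Y^{-(m+2)} of S = S^{-1}; as Y^{-2} begins with 12, the second factor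
-- begins with (12)^{-m}, which is itself a prefix of S of length > m. Hence the first m+1 letters of S recur
-- at position |w^{-(m+2)}| ≥ 1, and since m is arbitrary every occurring subword occurs again.

module Submission where

open import Defs
open import Data.Nat using (ℕ; zero; suc; _+_; _*_; _≤_; _<_; z≤n; s≤s; s≤s⁻¹; _%_)
open import Data.Nat.Properties
open import Data.Nat.Divisibility using (_∣_; _∣?_; divides; ∣m∣n⇒∣m+n; m%n≡0⇒n∣m)
open import Data.Nat.DivMod using (%-distribˡ-+; m%n<n)
open import Data.Nat.GeneralisedArithmetic using (iterate)
open import Data.List using ([]; _∷_; _++_; replicate; length)
open import Data.List.Properties using (∷-injective; ∷-injectiveˡ; ∷-injectiveʳ; length-++; ++-assoc)
open import Data.Product using (_×_; _,_; ∃-syntax; proj₁; proj₂)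
open import Data.Sum using (inj₁; inj₂)
open import Data.Empty using (⊥-elim)
open import Relation.Nullary using (¬_; yes; no)
open import Relation.Binary.PropositionalEquality
open import Function using (_∘_)
open import Function.Bundles using (_⇔_; mk⇔)

private variable
  c : Letter
  k m n N p q : ℕ
  s : InfWord
  x y : Word

odd+odd⇒even : ¬ 2 ∣ m → ¬ 2 ∣ n → 2 ∣ m + n
odd+odd⇒even {m} {n} odd-m odd-n = m%n≡0⇒n∣m (m + n) 2 (begin
  (m + n) % 2              ≡⟨ %-distribˡ-+ m n 2 ⟩
  (m % 2 + n % 2) % 2      ≡⟨ cong₂ (λ a b → (a + b) % 2) (odd⇒%2≡1 odd-m) (odd⇒%2≡1 odd-n) ⟩
  0                        ∎)
  where
  open ≡-Reasoning
  odd⇒%2≡1 : ∀ {a} → ¬ 2 ∣ a → a % 2 ≡ 1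
  odd⇒%2≡1 {a} odd-a with a % 2 in eq | m%n<n a 2
  ... | 0           | _            = ⊥-elim (odd-a (m%n≡0⇒n∣m a 2 eq))
  ... | 1           | _            = refl
  ... | suc (suc _) | s≤s (s≤s ())

other-involutive : ∀ c → other (other c) ≡ c
other-involutive one = refl
other-involutive two = refl

iterate-other-even : 2 ∣ n → iterate other c n ≡ c
iterate-other-even (divides q refl) = go q
  where
  go : ∀ q → iterate other c (q * 2) ≡ c
  go {c} zero    = refl
  go {c} (suc q) = trans (go q) (other-involutive c)

integralFrom-++ : ∀ c x y →
  integralFrom c (x ++ y) ≡ integralFrom c x ++ integralFrom (iterate other c (length x)) y
integralFrom-++ c []      y = refl
integralFrom-++ c (a ∷ x) y =
  trans (cong (replicate (val a) c ++_) (integralFrom-++ (other c) x y))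
        (sym (++-assoc (replicate (val a) c) _ _))

RegularBelow : ℕ → Word → Set
RegularBelow k w = ∀ h → h < k → 2 ∣ length (integralPow h w)

integralPow-++ : RegularBelow k x → integralPow k (x ++ y) ≡ integralPow k x ++ integralPow k y
integralPow-++ {zero}  reg = refl
integralPow-++ {suc k} {x} {y} reg = begin
  integral (integralPow k (x ++ y))
    ≡⟨ cong integral (integralPow-++ (λ h h<k → reg h (m<n⇒m<1+n h<k))) ⟩
  integral (integralPow k x ++ integralPow k y)
    ≡⟨ integralFrom-++ one (integralPow k x) (integralPow k y) ⟩
  integral (integralPow k x) ++ integralFrom (iterate other one (length (integralPow k x))) (integralPow k y)
    ≡⟨ cong (λ c → integral (integralPow k x) ++ integralFrom c (integralPow k y))
            (iterate-other-even (reg k (n<1+n k))) ⟩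
  integral (integralPow k x) ++ integral (integralPow k y) ∎
  where open ≡-Reasoning

integralPow-++-prefix : ∀ m x y → ∃[ z ] integralPow m (x ++ y) ≡ integralPow m x ++ z
integralPow-++-prefix zero    x y = y , refl
integralPow-++-prefix (suc m) x y with z , eq ← integralPow-++-prefix m x y =
  _ , trans (cong integral eq) (integralFrom-++ one (integralPow m x) z)

length-integralPow-++ : RegularBelow k x →
  length (integralPow k (x ++ y)) ≡ length (integralPow k x) + length (integralPow k y)
length-integralPow-++ {k} {x} {y} reg =
  trans (cong length (integralPow-++ reg)) (length-++ (integralPow k x))

RegularBelow-suc : RegularBelow k x → 2 ∣ length (integralPow k x) → RegularBelow (suc k) x
RegularBelow-suc reg even h h<1+k with m<1+n⇒m<n∨m≡n h<1+k
... | inj₁ h<k  = reg h h<k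
... | inj₂ refl = even

RegularBelow-++ : RegularBelow k x → RegularBelow k y →
  2 ∣ length (integralPow k x) + length (integralPow k y) → RegularBelow (suc k) (x ++ y)
RegularBelow-++ {k} {x} {y} reg-x reg-y even =
  RegularBelow-suc regular-below (subst (2 ∣_) (sym (length-integralPow-++ reg-x)) even)
  where
  regular-below : RegularBelow k (x ++ y)
  regular-below h h<k = subst (2 ∣_)
    (sym (length-integralPow-++ (λ h′ h′<h → reg-x h′ (<-trans h′<h h<k))))
    (∣m∣n⇒∣m+n (reg-x h h<k) (reg-y h h<k))

length-integralFrom-≥ : ∀ c x → length x ≤ length (integralFrom c x)
length-integralFrom-≥ c []        = z≤n
length-integralFrom-≥ c (one ∷ x) = s≤s (length-integralFrom-≥ (other c) x)
length-integralFrom-≥ c (two ∷ x) = s≤s (m≤n⇒m≤1+n (length-integralFrom-≥ (other c) x))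

length-integralPow-≥ : ∀ h x → length x ≤ length (integralPow h x)
length-integralPow-≥ zero    x = ≤-refl
length-integralPow-≥ (suc h) x =
  ≤-trans (length-integralPow-≥ h x) (length-integralFrom-≥ one (integralPow h x))

integralPow-+ : ∀ m n x → integralPow (m + n) x ≡ integralPow m (integralPow n x)
integralPow-+ zero    n x = refl
integralPow-+ (suc m) n x = cong integral (integralPow-+ m n x)

integralPow-2-prefix-12 : ∀ a b x → ∃[ z ] integralPow 2 (a ∷ b ∷ x) ≡ one ∷ two ∷ z
integralPow-2-prefix-12 one one x = _ , refl
integralPow-2-prefix-12 one two x = _ , refl
integralPow-2-prefix-12 two one x = _ , refl
integralPow-2-prefix-12 two two x = _ , refl

integralPow-12 : ∀ m → ∃[ z ] (integralPow m (one ∷ two ∷ []) ≡ one ∷ two ∷ z × m ≤ length z)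
integralPow-12 zero    = [] , refl , z≤n
integralPow-12 (suc m) with z , eq , m≤z ← integralPow-12 m =
  two ∷ integralFrom one z , cong integral eq , s≤s (≤-trans m≤z (length-integralFrom-≥ one z))

m<length-integralPow-12 : ∀ m → m < length (integralPow m (one ∷ two ∷ []))
m<length-integralPow-12 m with z , eq , m≤z ← integralPow-12 m rewrite eq = s≤s (m≤n⇒m≤1+n m≤z)

length-takeω : ∀ n s → length (takeω n s) ≡ n
length-takeω zero    s = refl
length-takeω (suc n) s = cong suc (length-takeω n (s ∘ suc))

takeω-isPrefix : ∀ n s → IsPrefix (takeω n s) s
takeω-isPrefix n s = cong (λ l → takeω l s) (length-takeω n s)

takeω-+ : ∀ p q s → takeω (p + q) s ≡ takeω p s ++ takeω q (dropω p s)
takeω-+ zero    q s = refl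
takeω-+ (suc p) q s = cong (s 0 ∷_) (takeω-+ p q (s ∘ suc))

IsPrefix-++⁻ : ∀ x y s → IsPrefix (x ++ y) s → IsPrefix x s × OccursAt y s (length x)
IsPrefix-++⁻ []      y s xy≼s = refl , xy≼s
IsPrefix-++⁻ (a ∷ x) y s xy≼s
  with head≡ , tail≼ ← ∷-injective xy≼s
  with x≼ , y-at ← IsPrefix-++⁻ x y (s ∘ suc) tail≼ = cong₂ _∷_ head≡ x≼ , y-at

IsPrefix-++⁺ : ∀ x y s → IsPrefix x s → OccursAt y s (length x) → IsPrefix (x ++ y) s
IsPrefix-++⁺ []      y s x≼s y-at = y-at
IsPrefix-++⁺ (a ∷ x) y s x≼s y-at =
  cong₂ _∷_ (∷-injectiveˡ x≼s) (IsPrefix-++⁺ x y (s ∘ suc) (∷-injectiveʳ x≼s) y-at)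

SameUpTo : ℕ → InfWord → InfWord → Set
SameUpTo N s t = ∀ j → j < N → s j ≡ t j

SameUpTo-≤ : ∀ {s t} → m ≤ n → SameUpTo n s t → SameUpTo m s t
SameUpTo-≤ m≤n same j j<m = same j (<-≤-trans j<m m≤n)

takeω-≡⇒SameUpTo : ∀ n s t → takeω n s ≡ takeω n t → SameUpTo n s t
takeω-≡⇒SameUpTo (suc n) s t eq zero    _         = ∷-injectiveˡ eq
takeω-≡⇒SameUpTo (suc n) s t eq (suc j) (s≤s j<n) =
  takeω-≡⇒SameUpTo n (s ∘ suc) (t ∘ suc) (∷-injectiveʳ eq) j j<n

SameUpTo⇒takeω-≡ : ∀ n s t → SameUpTo n s t → takeω n s ≡ takeω n t
SameUpTo⇒takeω-≡ zero    s t same = refl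
SameUpTo⇒takeω-≡ (suc n) s t same =
  cong₂ _∷_ (same 0 (s≤s z≤n)) (SameUpTo⇒takeω-≡ n (s ∘ suc) (t ∘ suc) (λ j j<n → same (suc j) (s≤s j<n)))

IsPrefix∧OccursAt⇒SameUpTo : IsPrefix x s → OccursAt x s p → SameUpTo (length x) (dropω p s) s
IsPrefix∧OccursAt⇒SameUpTo {x} {s} {p} x≼s x-at =
  takeω-≡⇒SameUpTo (length x) (dropω p s) s (trans x-at (sym x≼s))

SameUpTo-dropω-trans : SameUpTo (q + N) (dropω p s) s → SameUpTo N (dropω q s) s →
  SameUpTo N (dropω (p + q) s) s
SameUpTo-dropω-trans {q} {p = p} {s} same-p same-q j j<N =
  trans (cong s (+-assoc p q j)) (trans (same-p (q + j) (+-monoʳ-< q j<N)) (same-q j j<N))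

OccursAt-shift : ∀ u i → SameUpTo (i + length u) (dropω p s) s → OccursAt u s i → OccursAt u s (p + i)
OccursAt-shift {p} {s} u i same u-at =
  trans (SameUpTo⇒takeω-≡ (length u) (dropω (p + i) s) (dropω i s) same-at-i) u-at
  where
  same-at-i : SameUpTo (length u) (dropω (p + i) s) (dropω i s)
  same-at-i j j<u = trans (cong s (+-assoc p i j)) (same (i + j) (+-monoʳ-< i j<u))

RegularReturns : ℕ → InfWord → Set
RegularReturns k s = ∀ N → ∃[ p ] (1 ≤ p × RegularBelow k (takeω p s) × SameUpTo N (dropω p s) s)

recurrent⇒RegularReturns₀ : Recurrent s → RegularReturns 0 s
recurrent⇒RegularReturns₀ {s} rec N
  with i , j , i≢j , i-at , j-at ← rec (takeω N s) (0 , takeω-isPrefix N s) = nonzero-return i j i≢j i-at j-at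
  where
  return : ∀ p → OccursAt (takeω N s) s p → SameUpTo N (dropω p s) s
  return p at = subst (λ n → SameUpTo n (dropω p s) s) (length-takeω N s)
    (IsPrefix∧OccursAt⇒SameUpTo (takeω-isPrefix N s) at)
  nonzero-return : ∀ i j → i ≢ j → OccursAt (takeω N s) s i → OccursAt (takeω N s) s j →
    ∃[ p ] (1 ≤ p × RegularBelow 0 (takeω p s) × SameUpTo N (dropω p s) s)
  nonzero-return zero    zero    i≢j _    _    = ⊥-elim (i≢j refl)
  nonzero-return zero    (suc j) _   _    j-at = suc j , s≤s z≤n , (λ _ ()) , return (suc j) j-at
  nonzero-return (suc i) _       _   i-at _    = suc i , s≤s z≤n , (λ _ ()) , return (suc i) i-at

RegularReturns-suc : RegularReturns k s → RegularReturns (suc k) s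
RegularReturns-suc {k} {s} returns N
  with p , 1≤p , reg-p , same-p ← returns N
  with 2 ∣? length (integralPow k (takeω p s))
... | yes even-p = p , 1≤p , RegularBelow-suc reg-p even-p , same-p
... | no odd-p
  with q , 1≤q , reg-q , same-q ← returns (p + N)
  with 2 ∣? length (integralPow k (takeω q s))
... | yes even-q = q , 1≤q , RegularBelow-suc reg-q even-q , SameUpTo-≤ (m≤n+m N p) same-q
... | no odd-q = q + p , ≤-trans 1≤q (m≤m+n q p) , regular , SameUpTo-dropω-trans same-q same-p
  where
  concatenation : takeω (q + p) s ≡ takeω q s ++ takeω p s
  concatenation = trans (takeω-+ q p s)
    (cong (takeω q s ++_) (SameUpTo⇒takeω-≡ p (dropω q s) s (SameUpTo-≤ (m≤m+n p N) same-q)))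
  regular : RegularBelow (suc k) (takeω (q + p) s)
  regular = subst (RegularBelow (suc k)) (sym concatenation)
    (RegularBelow-++ reg-q reg-p (odd+odd⇒even odd-q odd-p))

recurrent⇒RegularReturns : Recurrent s → ∀ k → RegularReturns k s
recurrent⇒RegularReturns rec zero    = recurrent⇒RegularReturns₀ rec
recurrent⇒RegularReturns rec (suc k) = RegularReturns-suc (recurrent⇒RegularReturns rec k)

recurrent⇒HasKRegularPrefix : Recurrent s → ∀ k → HasKRegularPrefix k s
recurrent⇒HasKRegularPrefix {s} rec k
  with p , 1≤p , regular , _ ← recurrent⇒RegularReturns rec (suc k) 0 =
  takeω p s , subst (1 ≤_) (sym (length-takeω p s)) 1≤p , takeω-isPrefix p s ,
  λ h h≤k → regular h (s≤s h≤k)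

module _ {S : InfWord} (kolakoski : IsKolakoski S) where

  integral-isPrefix : IsPrefix x S → IsPrefix (integral x) S
  integral-isPrefix {x} x≼S = subst (λ y → IsPrefix (integral y) S) x≼S (kolakoski (length x))

  integralPow-isPrefix : ∀ h → IsPrefix x S → IsPrefix (integralPow h x) S
  integralPow-isPrefix zero    x≼S = x≼S
  integralPow-isPrefix (suc h) x≼S = integral-isPrefix (integralPow-isPrefix h x≼S)

  kolakoski-head : S 0 ≡ one
  kolakoski-head = from-integral (S 0) (kolakoski 1)
    where
    from-integral : ∀ a → IsPrefix (integral (a ∷ [])) S → S 0 ≡ one
    from-integral one ≼S = ∷-injectiveˡ ≼S
    from-integral two ≼S = ∷-injectiveˡ ≼S

  kolakoski-12 : IsPrefix (one ∷ two ∷ []) S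
  kolakoski-12 = from-integral (S 1)
    (subst (λ a → IsPrefix (integral (a ∷ S 1 ∷ [])) S) kolakoski-head (kolakoski 2))
    where
    from-integral : ∀ b → IsPrefix (integral (one ∷ b ∷ [])) S → IsPrefix (one ∷ two ∷ []) S
    from-integral one ≼S = ≼S
    from-integral two ≼S = proj₁ (IsPrefix-++⁻ (one ∷ two ∷ []) (two ∷ []) S ≼S)

  regularPrefix-returns : ∀ m {w} → IsPrefix w S → RegularBelow (2 + m) w →
    SameUpTo (suc m) (dropω (length (integralPow (2 + m) w)) S) S
  regularPrefix-returns m {w} w≼S regular
    with t , Y²≡12t ← integralPow-2-prefix-12 (S (length w + 0)) (S (length w + 1)) []
    with z , 12t≡Xz ← integralPow-++-prefix m (one ∷ two ∷ []) t =
    SameUpTo-≤ (m<length-integralPow-12 m)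
      (IsPrefix∧OccursAt⇒SameUpTo (integralPow-isPrefix m kolakoski-12) X-at)
    where
    Y : Word
    Y = takeω 2 (dropω (length w) S)
    W : Word
    W = integralPow (2 + m) w
    X : Word
    X = integralPow m (one ∷ two ∷ [])
    integral-Y : integralPow (2 + m) Y ≡ X ++ z
    integral-Y = begin
      integralPow (2 + m) Y              ≡⟨ cong (λ n → integralPow n Y) (+-comm 2 m) ⟩
      integralPow (m + 2) Y              ≡⟨ integralPow-+ m 2 Y ⟩
      integralPow m (integralPow 2 Y)    ≡⟨ cong (integralPow m) Y²≡12t ⟩
      integralPow m (one ∷ two ∷ t)      ≡⟨ 12t≡Xz ⟩
      X ++ z                             ∎
      where open ≡-Reasoning
    WXz≼S : IsPrefix (W ++ (X ++ z)) S
    WXz≼S = subst (λ v → IsPrefix v S)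
      (trans (integralPow-++ regular) (cong (W ++_) integral-Y))
      (integralPow-isPrefix (2 + m) (IsPrefix-++⁺ w Y S w≼S refl))
    X-at : OccursAt X S (length W)
    X-at = proj₁ (IsPrefix-++⁻ X z (dropω (length W) S) (proj₂ (IsPrefix-++⁻ W (X ++ z) S WXz≼S)))

  hasKRegularPrefix⇒recurrent : (∀ k → 1 ≤ k → HasKRegularPrefix k S) → Recurrent S
  hasKRegularPrefix⇒recurrent regular-prefixes u (i , u-at)
    with w , 1≤w , w≼S , regular ← regular-prefixes (suc (i + length u)) (s≤s z≤n) =
    i , period + i , <⇒≢ (m<n+m i 0<period) , u-at , OccursAt-shift u i returns u-at
    where
    window : ℕ
    window = i + length u
    period : ℕ
    period = length (integralPow (2 + window) w)
    0<period : 0 < period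
    0<period = ≤-trans 1≤w (length-integralPow-≥ (2 + window) w)
    returns : SameUpTo window (dropω period S) S
    returns = SameUpTo-≤ (n≤1+n window)
      (regularPrefix-returns window w≼S (λ h h<2+window → regular h (s≤s⁻¹ h<2+window)))

lemma8 : (S : InfWord) → IsKolakoski S →
    (Recurrent S ⇔ (∀ (k : ℕ) → 1 ≤ k → HasKRegularPrefix k S))
lemma8 S kolakoski =
  mk⇔ (λ rec k _ → recurrent⇒HasKRegularPrefix rec k) (hasKRegularPrefix⇒recurrent kolakoski)
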